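{- Let $H_4$ be the $3$-hypertournament with vertex set $V(H_4)=\{1,2,3,4\}$ and arc set $A(H_4)=\{(2,3,4),(4,1,2),(3,4,1),(1,2,3)\}$. If $H$ is a $k$-hypertournament on $n$ vertices with $H\cong H_4$, then $H$ does not contain an antidirected hamiltonian path.
   Context: A $k$-hypertournament $H$ on $n$ vertices is a pair $(V(H),A(H))$ where $V(H)$ is a set of $n$ vertices and $A(H)$ is a set of $k$-tuples of distinct vertices (arcs) such that for every $k$-subset $S\subseteq V(H)$, $A(H)$ contains exactly one of the $k!$ $k$-tuples whose entries are the elements of $S$. For an arc $a=(y_1,\dots,y_k)$ and $i<j$, we say $y_i$ precedes $y_j$ in $a$. Two hypertournaments are isomorphic if there is a bijection between their vertex sets mapping the arc set of one onto the arc set of the other. An antidirected path in $H$ is a sequence $x_1a_1x_2a_2\cdots x_{t-1}a_{t-1}x_t$ ($t\ge 2$) of distinct vertices $x_1,\dots,x_t$ and distinct arcs $a_1,\dots,a_{t-1}$, where each arc $a_i$ contains $x_i$ and $x_{i+1}$, such that for every $i\in\{2,\dots,t-1\}$ either ($x_{i-1}$ precedes $x_i$ in $a_{i-1}$ and $x_{i+1}$ precedes $x_i$ in $a_i$) or ($x_i$ precedes $x_{i-1}$ in $a_{i-1}$ and $x_i$ precedes $x_{i+1}$ in $a_i$). An antidirected hamiltonian path is an antidirected path containing every vertex of $H$. -}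

module Defs where

open import Data.Nat using (ℕ; zero; suc; _≤_)
open import Data.Fin using (Fin; toℕ; inject₁; zero; suc)
open import Data.List using (List; []; _∷_; _++_; length; map)
open import Data.List.Membership.Propositional using (_∈_)
open import Data.List.Relation.Unary.Unique.Propositional using (Unique)
open import Data.List.Relation.Binary.Permutation.Propositional using (_↭_)
open import Data.Product using (Σ; ∃; _×_; _,_)
open import Data.Sum using (_⊎_)
open import Function.Bundles using (_⤖_; _⇔_; module Bijection)
open import Function.Definitions using (Injective)
open import Relation.Binary.PropositionalEquality using (_≡_)

-- A k-hypertournament on the vertex set Fin n: a set (predicate) of arcs,
-- each arc a k-tuple of distinct vertices, such that for every k-subset S
-- (= a duplicate-free list s of length k, up to permutation) exactly one
-- tuple whose entries are the elements of S is an arc.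
record HT (k n : ℕ) : Set₁ where
  field
    Arc        : List (Fin n) → Set
    arc-len    : ∀ a → Arc a → length a ≡ k
    arc-uniq   : ∀ a → Arc a → Unique a
    arc-exists : ∀ s → length s ≡ k → Unique s → ∃ λ a → Arc a × (a ↭ s)
    arc-unique : ∀ a b → Arc a → Arc b → a ↭ b → a ≡ b
open HT public

Precedes : ∀ {n} → List (Fin n) → Fin n → Fin n → Set
Precedes a y z = ∃ λ l₁ → ∃ λ l₂ → ∃ λ l₃ → a ≡ l₁ ++ y ∷ l₂ ++ z ∷ l₃

Iso : ∀ {k n n'} → HT k n → (List (Fin n') → Set) → Set
Iso {n = n} {n' = n'} H A' =
  Σ (Fin n ⤖ Fin n') λ f →
    ∀ a → Arc H a ⇔ A' (map (Bijection.to f) a)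

-- H₄ : vertices 1,2,3,4 are encoded as 0,1,2,3 in Fin 4.
-- A(H₄) = {(2,3,4),(4,1,2),(3,4,1),(1,2,3)}
v1 v2 v3 v4 : Fin 4
v1 = zero
v2 = suc zero
v3 = suc (suc zero)
v4 = suc (suc (suc zero))

H4arcs : List (List (Fin 4))
H4arcs = (v2 ∷ v3 ∷ v4 ∷ []) ∷ (v4 ∷ v1 ∷ v2 ∷ []) ∷ (v3 ∷ v4 ∷ v1 ∷ [])
       ∷ (v1 ∷ v2 ∷ v3 ∷ []) ∷ []

H4Arc : List (Fin 4) → Set
H4Arc a = a ∈ H4arcs

-- An antidirected hamiltonian path x₁ a₁ x₂ … a_{t-1} x_t with t = suc m ≥ 2.
-- Vertices x : Fin (suc m) → Fin n (0-indexed), arcs a : Fin m → arcs,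
-- arc a i joins x (inject₁ i) and x (suc i).
record AntidirectedHamPath {k n : ℕ} (H : HT k n) : Set where
  field
    m           : ℕ
    t≥2         : 1 ≤ m
    x           : Fin (suc m) → Fin n
    a           : Fin m → List (Fin n)
    x-distinct  : Injective _≡_ _≡_ x
    a-distinct  : Injective _≡_ _≡_ a
    a-arc       : ∀ i → Arc H (a i)
    a-contains  : ∀ i → (x (inject₁ i) ∈ a i) × (x (suc i) ∈ a i)
    alternating : ∀ i j → toℕ j ≡ suc (toℕ i) →
      (Precedes (a i) (x (inject₁ i)) (x (suc i)) × Precedes (a j) (x (suc j)) (x (suc i)))
      ⊎ (Precedes (a i) (x (suc i)) (x (inject₁ i)) × Precedes (a j) (x (suc i)) (x (suc j)))
    hamiltonian : ∀ v → ∃ λ i → x i ≡ v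

{-# OPTIONS --safe #-}
-- An isomorphism onto H₄ carries an antidirected hamiltonian path of H to an
-- antidirected walk in H₄ through four distinct vertices along (at least) three
-- distinct arcs. But in H₄ every antidirected walk along three distinct arcs
-- returns to its starting vertex, as an exhaustive check of the 4⁴ · 4³
-- candidate walks shows.
module Submission where

open import Defs
open import Data.Nat using (ℕ; suc; _≤_; s≤s)
open import Data.Nat.Properties using (≤-trans; ≤-pred)
open import Data.Fin as Fin using (Fin; zero; suc; _≟_)
open import Data.Fin.Properties using (all?; injective⇒≤)
open import Data.List using (List; []; _∷_; _++_; map)
open import Data.List.Properties using (map-++; map-injective; ≡-dec)
open import Data.List.Relation.Unary.Any using (here)
open import Data.List.Relation.Unary.All as All using (All)
open import Data.List.Membership.Propositional using (_∈_)
open import Data.List.Membership.Propositional.Properties using (∈-++⁺ʳ; ∈-∃++)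
open import Data.Product as Product using (_×_; _,_; proj₁; proj₂)
open import Data.Sum as Sum using (_⊎_; inj₁; inj₂)
open import Function.Bundles using (module Bijection; module Equivalence)
open import Function.Definitions using (Injective)
open import Function.Properties.Bijection using (sym-≡)
open import Relation.Nullary using (¬_; Dec; no; ¬?; _×-dec_; _⊎-dec_; _→-dec_)
open import Relation.Nullary.Decidable using (map′; from-yes)
open import Relation.Binary.Definitions using (DecidableEquality)
open import Relation.Binary.PropositionalEquality using (_≡_; _≢_; refl; sym; trans; cong)

module _ {n : ℕ} where

  open import Data.List.Membership.DecPropositional (_≟_ {n}) using (_∈?_)

  precedes-∷⁻ : ∀ {c : Fin n} {l u v} → Precedes (c ∷ l) u v → (c ≡ u × v ∈ l) ⊎ Precedes l u v
  precedes-∷⁻ ([]     , l₂ , l₃ , refl) = inj₁ (refl , ∈-++⁺ʳ l₂ (here refl))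
  precedes-∷⁻ (_ ∷ l₁ , l₂ , l₃ , refl) = inj₂ (l₁ , l₂ , l₃ , refl)

  precedes-∷⁺ : ∀ {c : Fin n} {l u v} → (c ≡ u × v ∈ l) ⊎ Precedes l u v → Precedes (c ∷ l) u v
  precedes-∷⁺ (inj₁ (refl , v∈l)) with l₂ , l₃ , refl ← ∈-∃++ v∈l = [] , l₂ , l₃ , refl
  precedes-∷⁺ {c} (inj₂ (l₁ , l₂ , l₃ , refl)) = c ∷ l₁ , l₂ , l₃ , refl

  precedes? : (a : List (Fin n)) (u v : Fin n) → Dec (Precedes a u v)
  precedes? []      u v = no λ { ([] , _ , _ , ()) ; (_ ∷ _ , _ , _ , ()) }
  precedes? (c ∷ l) u v =
    map′ precedes-∷⁺ precedes-∷⁻ ((c ≟ u ×-dec v ∈? l) ⊎-dec precedes? l u v)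

precedes-map : ∀ {n n'} (f : Fin n → Fin n') {a u v} →
               Precedes a u v → Precedes (map f a) (f u) (f v)
precedes-map f {u = u} {v} (l₁ , l₂ , l₃ , refl) =
  map f l₁ , map f l₂ , map f l₃ ,
  trans (map-++ f l₁ (u ∷ _)) (cong (λ l → map f l₁ ++ f u ∷ l) (map-++ f l₂ (v ∷ l₃)))

Alternates : ∀ {n} → List (Fin n) → List (Fin n) → Fin n → Fin n → Fin n → Set
Alternates a b u v w = (Precedes a u v × Precedes b w v) ⊎ (Precedes a v u × Precedes b v w)

alternates? : ∀ {n} (a b : List (Fin n)) (u v w : Fin n) → Dec (Alternates a b u v w)
alternates? a b u v w =
  (precedes? a u v ×-dec precedes? b w v) ⊎-dec (precedes? a v u ×-dec precedes? b v w)

alternates-map : ∀ {n n'} (f : Fin n → Fin n') {a b u v w} →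
                 Alternates a b u v w → Alternates (map f a) (map f b) (f u) (f v) (f w)
alternates-map f = Sum.map (Product.map (precedes-map f) (precedes-map f))
                           (Product.map (precedes-map f) (precedes-map f))

-- The conclusion cannot be strengthened to ⊥: 1 (1,2,3) 2 (4,1,2) 4 (3,4,1) 1
-- is a closed antidirected walk along three distinct arcs of H₄.
H4-antidirected-walk-closes :
  ∀ {b₀ b₁ b₂} → b₀ ∈ H4arcs → b₁ ∈ H4arcs → b₂ ∈ H4arcs →
  b₀ ≢ b₁ → b₁ ≢ b₂ → b₀ ≢ b₂ →
  ∀ {y₀ y₁ y₂ y₃} → Alternates b₀ b₁ y₀ y₁ y₂ → Alternates b₁ b₂ y₁ y₂ y₃ → y₀ ≡ y₃
H4-antidirected-walk-closes b₀∈ b₁∈ b₂∈ b₀≢b₁ b₁≢b₂ b₀≢b₂ {y₀} {y₁} {y₂} {y₃} =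
  All.lookup (All.lookup (All.lookup (from-yes every-walk-closes? y₀ y₁ y₂ y₃) b₀∈) b₁∈) b₂∈
    b₀≢b₁ b₁≢b₂ b₀≢b₂
  where
  Closes : (b₀ b₁ b₂ : List (Fin 4)) (y₀ y₁ y₂ y₃ : Fin 4) → Set
  Closes b₀ b₁ b₂ y₀ y₁ y₂ y₃ = b₀ ≢ b₁ → b₁ ≢ b₂ → b₀ ≢ b₂ →
    Alternates b₀ b₁ y₀ y₁ y₂ → Alternates b₁ b₂ y₁ y₂ y₃ → y₀ ≡ y₃

  closes? : ∀ b₀ b₁ b₂ y₀ y₁ y₂ y₃ → Dec (Closes b₀ b₁ b₂ y₀ y₁ y₂ y₃)
  closes? b₀ b₁ b₂ y₀ y₁ y₂ y₃ =
    ¬? (b₀ ≟ₗ b₁) →-dec ¬? (b₁ ≟ₗ b₂) →-dec ¬? (b₀ ≟ₗ b₂) →-dec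
    alternates? b₀ b₁ y₀ y₁ y₂ →-dec alternates? b₁ b₂ y₁ y₂ y₃ →-dec y₀ ≟ y₃
    where
    _≟ₗ_ : DecidableEquality (List (Fin 4))
    _≟ₗ_ = ≡-dec _≟_

  every-walk-closes? : Dec (∀ y₀ y₁ y₂ y₃ →
    All (λ b₀ → All (λ b₁ → All (λ b₂ → Closes b₀ b₁ b₂ y₀ y₁ y₂ y₃) H4arcs) H4arcs) H4arcs)
  every-walk-closes? = all? λ y₀ → all? λ y₁ → all? λ y₂ → all? λ y₃ →
    All.all? (λ b₀ → All.all? (λ b₁ → All.all? (λ b₂ →
      closes? b₀ b₁ b₂ y₀ y₁ y₂ y₃) H4arcs) H4arcs) H4arcs

module _ {k n} {H : HT k n} where

  vertices≤1+arcs : (P : AntidirectedHamPath H) → n ≤ suc (AntidirectedHamPath.m P)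
  vertices≤1+arcs P = injective⇒≤ position-injective
    where
    open AntidirectedHamPath P
    position-injective : Injective _≡_ _≡_ (λ v → proj₁ (hamiltonian v))
    position-injective {v} {w} e =
      trans (sym (proj₂ (hamiltonian v))) (trans (cong x e) (proj₂ (hamiltonian w)))

  module _ (F : Fin n → Fin 4) (F-injective : Injective _≡_ _≡_ F)
           (F-arcs : ∀ a → Arc H a → H4Arc (map F a)) where

    antidirected-path-into-H4-is-short :
      (P : AntidirectedHamPath H) → ¬ 3 ≤ AntidirectedHamPath.m P
    antidirected-path-into-H4-is-short record { m = 0 } ()
    antidirected-path-into-H4-is-short record { m = 1 } (s≤s ())
    antidirected-path-into-H4-is-short record { m = 2 } (s≤s (s≤s ()))
    antidirected-path-into-H4-is-short
      record { m = suc (suc (suc m)) ; x = x ; a = a ; x-distinct = x-distinct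
             ; a-distinct = a-distinct ; a-arc = a-arc ; alternating = alternating } _
      = 0≢3 (x-distinct (F-injective (H4-antidirected-walk-closes
          (image-arc i₀) (image-arc i₁) (image-arc i₂)
          (image-distinct λ ()) (image-distinct λ ()) (image-distinct λ ())
          (alternates-map F (alternating i₀ i₁ refl))
          (alternates-map F (alternating i₁ i₂ refl)))))
      where
      i₀ i₁ i₂ : Fin (suc (suc (suc m)))
      i₀ = zero
      i₁ = suc zero
      i₂ = suc (suc zero)
      image-arc : ∀ i → H4Arc (map F (a i))
      image-arc i = F-arcs (a i) (a-arc i)
      image-distinct : ∀ {i j} → i ≢ j → map F (a i) ≢ map F (a j)
      image-distinct i≢j e = i≢j (a-distinct (map-injective F-injective e))
      0≢3 : ¬ zero ≡ Fin.suc {suc (suc (suc m))} (suc (suc zero))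
      0≢3 ()

proposition2p1 : ∀ {k n : ℕ} (H : HT k n) → Iso H H4Arc → ¬ AntidirectedHamPath H
proposition2p1 {n = n} H (f , iso) P =
  antidirected-path-into-H4-is-short (Bijection.to f) (Bijection.injective f)
    (λ a → Equivalence.to (iso a)) P (≤-pred (≤-trans 4≤n (vertices≤1+arcs P)))
  where
  4≤n : 4 ≤ n
  4≤n = injective⇒≤ (Bijection.injective (sym-≡ f))
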